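{- Let $G$ be a weighted tree with root $r$ and goal $g$, let $\varepsilon\in(0,1)$, and let $f$ satisfy $(1-\varepsilon)d_G(v,g)\le f(v)\le(1+\varepsilon)d_G(v,g)$ for all $v$. Let $S_{\varepsilon,r}=\{v\in V: d_G(v,r)\le\frac{1}{1-\varepsilon}f(r)\}$ and $\mathrm{OPT}=d_G(r,g)$. Then: (i) for all $v\notin S_{\varepsilon,r}$, $d_G(v,r)>\mathrm{OPT}$; (ii) for all $v\in S_{\varepsilon,r}$, $d_G(v,r)\le\frac{1+\varepsilon}{1-\varepsilon}\mathrm{OPT}$; (iii) for all $v\in S_{\varepsilon,r}$, $d_G(v,g)\le\frac{2}{1-\varepsilon}\mathrm{OPT}$; (iv) $P_G(r,g)\subseteq S_{\varepsilon,r}$; (v) for every $v\in S_{\varepsilon,r}$, $P_G(v,g)\subseteq S_{\varepsilon,r}$.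
   Context: $G=(V,E)$ is a finite undirected tree with positive edge weights and shortest-path distance $d_G$. $P_G(u,v)$ denotes the set of vertices on the unique path between $u$ and $v$ in $G$. -}

module Defs where

open import Level using (0ℓ)
open import Data.Nat using (ℕ)
open import Data.Fin using (Fin)
open import Data.List using (List; []; _∷_)
open import Data.List.Membership.Propositional using (_∈_)
open import Data.List.Relation.Unary.Unique.Propositional using (Unique)
open import Data.Product using (Σ; ∃; _×_; _,_)
open import Data.Sum using (_⊎_)
open import Relation.Nullary using (¬_)
open import Relation.Binary.PropositionalEquality using (_≡_)
import Algebra.Structures as AS
open import Relation.Binary.Structures using (IsStrictTotalOrder)

-- The real numbers, axiomatised as a complete ordered field
-- (any two models are isomorphic, so quantifying over models = ℝ).

record RealField : Set₁ where
  infixl 6 _+_ _-_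
  infixl 7 _*_ _/_
  infix  4 _<_ _≤_
  field
    ℝ     : Set
    _+_   : ℝ → ℝ → ℝ
    _*_   : ℝ → ℝ → ℝ
    -_    : ℝ → ℝ
    0r    : ℝ
    1r    : ℝ
    _⁻¹   : ℝ → ℝ
    _<_   : ℝ → ℝ → Set
    isCommutativeRing  : AS.IsCommutativeRing (_≡_ {A = ℝ}) _+_ _*_ -_ 0r 1r
    isStrictTotalOrder : IsStrictTotalOrder (_≡_ {A = ℝ}) _<_
    ⁻¹-inverse : ∀ x → ¬ (x ≡ 0r) → x * (x ⁻¹) ≡ 1r
    0<1        : 0r < 1r
    +-mono-<   : ∀ x y z → x < y → x + z < y + z
    *-pos      : ∀ x y → 0r < x → 0r < y → 0r < x * y

  _≤_ : ℝ → ℝ → Set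
  x ≤ y = (x < y) ⊎ (x ≡ y)

  _-_ : ℝ → ℝ → ℝ
  x - y = x + (- y)

  _/_ : ℝ → ℝ → ℝ
  x / y = x * (y ⁻¹)

  field
    complete : (P : ℝ → Set) → Σ ℝ P → Σ ℝ (λ b → ∀ x → P x → x ≤ b) →
               Σ ℝ (λ s → (∀ x → P x → x ≤ s) ×
                          (∀ b → (∀ x → P x → x ≤ b) → s ≤ b))

module Graphs (F : RealField) where
  open RealField F

  record WeightedGraph (n : ℕ) : Set₁ where
    field
      Adj      : Fin n → Fin n → Set
      w        : Fin n → Fin n → ℝ
      Adj-sym  : ∀ {u v} → Adj u v → Adj v u
      Adj-irr  : ∀ {u} → ¬ Adj u u
      w-sym    : ∀ {u v} → Adj u v → w u v ≡ w v u
      w-pos    : ∀ {u v} → Adj u v → 0r < w u v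

  module _ {n : ℕ} (G : WeightedGraph n) where
    open WeightedGraph G

    data Walk : Fin n → Fin n → Set where
      []  : ∀ {u} → Walk u u
      _∷_ : ∀ {u v x} → Adj u v → Walk v x → Walk u x

    vertices : ∀ {u v} → Walk u v → List (Fin n)
    vertices {u} []      = u ∷ []
    vertices {u} (_ ∷ p) = u ∷ vertices p

    len : ∀ {u v} → Walk u v → ℝ
    len []              = 0r
    len {u} (_∷_ {v = v} _ p) = w u v + len p

    Path : Fin n → Fin n → Set
    Path u v = Σ (Walk u v) (λ p → Unique (vertices p))

    IsTree : Set
    IsTree = ∀ u v → Σ (Path u v) (λ p → ∀ (q : Path u v) →
               vertices (Data.Product.proj₁ q) ≡ vertices (Data.Product.proj₁ p))

    IsShortestPathDist : (Fin n → Fin n → ℝ) → Set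
    IsShortestPathDist d = ∀ u v →
      Σ (Walk u v) (λ p → len p ≡ d u v) × (∀ (p : Walk u v) → d u v ≤ len p)

    OnPath : Fin n → Fin n → Fin n → Set
    OnPath u v x = Σ (Path u v) (λ p → x ∈ vertices (Data.Product.proj₁ p))

-- The threshold T = f(r)/(1-ε) lies between OPT and (1+ε)/(1-ε)·OPT, because
-- (1-ε)·OPT ≤ f(r) ≤ (1+ε)·OPT. This gives (i) and (ii) at once, and (iii) is the
-- triangle inequality through r. In a tree the vertices of the path between two
-- vertices lie on EVERY walk between them (loop erasure turns the walk into a path,
-- and the path is unique). For (iv), a vertex x on a shortest r–g walk has
-- d(x,r) ≤ OPT ≤ T. For (v), the path from v to g lies on a shortest walk v → r
-- followed by a shortest walk r → g; a vertex x on the first has d(x,r) ≤ d(v,r) ≤ T,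
-- and on the second d(x,r) ≤ OPT ≤ T.
module Submission where

open import Defs
open import Data.Nat using (ℕ)
open import Data.Fin using (Fin)
open import Data.Product using (Σ; _×_; _,_; proj₁; proj₂)
open import Data.Sum using (_⊎_; inj₁; inj₂; [_,_])
open import Data.Empty using (⊥-elim)
open import Data.List.Membership.Propositional using (_∈_)
open import Data.List.Relation.Binary.Subset.Propositional using (_⊆_)
open import Data.List.Relation.Unary.Any using (here; there)
open import Data.List.Relation.Unary.All using ([])
open import Data.List.Relation.Unary.All.Properties using (¬Any⇒All¬)
open import Data.List.Relation.Unary.AllPairs using ([]; _∷_)
open import Data.List.Relation.Unary.Unique.Propositional using (Unique)
open import Relation.Nullary using (¬_; yes; no)
open import Relation.Binary.PropositionalEquality
  using (_≡_; refl; sym; trans; cong; cong₂; subst; subst₂; module ≡-Reasoning)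
open import Relation.Binary.Structures using (IsStrictTotalOrder)
open import Relation.Binary.Definitions using (tri<; tri≈; tri>)
open import Algebra.Bundles using (CommutativeRing)
open import Algebra.Structures using (IsCommutativeRing)
import Algebra.Properties.CommutativeSemigroup as CommutativeSemigroupProperties
import Algebra.Properties.Ring as RingProperties
import Data.List.Membership.DecPropositional as DecMembership

module OrderedFieldProperties (F : RealField) where
  open RealField F
  open IsStrictTotalOrder isStrictTotalOrder using (compare) renaming (trans to <-trans)
  open IsCommutativeRing isCommutativeRing
    using ( +-identityˡ; +-identityʳ; +-assoc; +-comm; -‿inverseˡ; -‿inverseʳ
          ; *-identityˡ; zeroʳ; distribʳ)

  commutativeRing : CommutativeRing _ _
  commutativeRing = record { isCommutativeRing = isCommutativeRing }

  open RingProperties (CommutativeRing.ring commutativeRing) using (x[y-z]≈xy-xz; -‿distribʳ-*)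

  open CommutativeSemigroupProperties (CommutativeRing.*-commutativeSemigroup commutativeRing)
    using (x∙yz≈yx∙z)
  open CommutativeSemigroupProperties (CommutativeRing.+-commutativeSemigroup commutativeRing)
    using (interchange)

  <-irrefl : ∀ {x} → ¬ (x < x)
  <-irrefl = IsStrictTotalOrder.irrefl isStrictTotalOrder refl

  ≤-reflexive : ∀ {x y} → x ≡ y → x ≤ y
  ≤-reflexive = inj₂

  ≤-refl : ∀ {x} → x ≤ x
  ≤-refl = ≤-reflexive refl

  ≤-trans : ∀ {x y z} → x ≤ y → y ≤ z → x ≤ z
  ≤-trans (inj₁ x<y) (inj₁ y<z) = inj₁ (<-trans x<y y<z)
  ≤-trans (inj₁ x<y) (inj₂ refl) = inj₁ x<y
  ≤-trans (inj₂ refl) y≤z = y≤z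

  ≤-<-trans : ∀ {x y z} → x ≤ y → y < z → x < z
  ≤-<-trans (inj₁ x<y) y<z = <-trans x<y y<z
  ≤-<-trans (inj₂ refl) y<z = y<z

  ≰⇒> : ∀ {x y} → ¬ (x ≤ y) → y < x
  ≰⇒> {x} {y} x≰y with compare x y
  ... | tri< x<y _ _ = ⊥-elim (x≰y (inj₁ x<y))
  ... | tri≈ _ x≡y _ = ⊥-elim (x≰y (inj₂ x≡y))
  ... | tri> _ _ y<x = y<x

  +-monoˡ-≤ : ∀ {x y} z → x ≤ y → x + z ≤ y + z
  +-monoˡ-≤ z (inj₁ x<y) = inj₁ (+-mono-< _ _ z x<y)
  +-monoˡ-≤ z (inj₂ refl) = ≤-refl

  +-monoʳ-≤ : ∀ {x y} z → x ≤ y → z + x ≤ z + y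
  +-monoʳ-≤ {x} {y} z x≤y rewrite +-comm z x | +-comm z y = +-monoˡ-≤ z x≤y

  x<y+x : ∀ {y} x → 0r < y → x < y + x
  x<y+x {y} x 0<y = subst (_< y + x) (+-identityˡ x) (+-mono-< _ _ x 0<y)

  <⇒0<- : ∀ {x y} → x < y → 0r < y - x
  <⇒0<- {x} {y} x<y = subst (_< y - x) (-‿inverseʳ x) (+-mono-< _ _ (- x) x<y)

  0<-⇒< : ∀ {x y} → 0r < y - x → x < y
  0<-⇒< {x} {y} 0<y-x = subst₂ _<_ (+-identityˡ x) y-x+x≡y (+-mono-< _ _ x 0<y-x)
    where
    y-x+x≡y : (y - x) + x ≡ y
    y-x+x≡y = trans (+-assoc y (- x) x) (trans (cong (y +_) (-‿inverseˡ x)) (+-identityʳ y))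

  *-monoˡ-≤ : ∀ {c x y} → 0r < c → x ≤ y → c * x ≤ c * y
  *-monoˡ-≤ {c} {x} {y} 0<c (inj₁ x<y) =
    inj₁ (0<-⇒< (subst (0r <_) (x[y-z]≈xy-xz c y x) (*-pos c _ 0<c (<⇒0<- x<y))))
  *-monoˡ-≤ 0<c (inj₂ refl) = ≤-refl

  <0⇒0<- : ∀ {x} → x < 0r → 0r < - x
  <0⇒0<- {x} x<0 = subst₂ _<_ (-‿inverseʳ x) (+-identityˡ (- x)) (+-mono-< _ _ (- x) x<0)

  0<-⇒<0 : ∀ {x} → 0r < - x → x < 0r
  0<-⇒<0 {x} 0<-x = subst₂ _<_ (+-identityˡ x) (-‿inverseˡ x) (+-mono-< _ _ x 0<-x)

  >⇒≢0 : ∀ {x} → 0r < x → ¬ (x ≡ 0r)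
  >⇒≢0 0<x refl = <-irrefl 0<x

  ⁻¹-pos : ∀ {x} → 0r < x → 0r < x ⁻¹
  ⁻¹-pos {x} 0<x with compare 0r (x ⁻¹)
  ... | tri< 0<x⁻¹ _ _ = 0<x⁻¹
  ... | tri≈ _ 0≡x⁻¹ _ = ⊥-elim (<-irrefl (subst (0r <_) 1≡0 0<1))
    where
    1≡0 : 1r ≡ 0r
    1≡0 = trans (sym (⁻¹-inverse x (>⇒≢0 0<x))) (trans (cong (x *_) (sym 0≡x⁻¹)) (zeroʳ x))
  ... | tri> _ _ x⁻¹<0 = ⊥-elim (<-irrefl (<-trans 0<1 (0<-⇒<0 0<-1)))
    where
    0<-1 : 0r < - 1r
    0<-1 = subst (0r <_) (trans (sym (-‿distribʳ-* x (x ⁻¹)))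
                                (cong -_ (⁻¹-inverse x (>⇒≢0 0<x))))
                 (*-pos x _ 0<x (<0⇒0<- x⁻¹<0))

  1/-pos : ∀ {a} → 0r < a → 0r < 1r / a
  1/-pos {a} 0<a = subst (0r <_) (sym (*-identityˡ (a ⁻¹))) (⁻¹-pos 0<a)

  1/a*[a*y]≡y : ∀ {a} → ¬ (a ≡ 0r) → ∀ y → (1r / a) * (a * y) ≡ y
  1/a*[a*y]≡y {a} a≢0 y = begin
    (1r * a ⁻¹) * (a * y)  ≡⟨ cong (_* (a * y)) (*-identityˡ (a ⁻¹)) ⟩
    a ⁻¹ * (a * y)         ≡⟨ x∙yz≈yx∙z (a ⁻¹) a y ⟩
    (a * a ⁻¹) * y         ≡⟨ cong (_* y) (⁻¹-inverse a a≢0) ⟩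
    1r * y                 ≡⟨ *-identityˡ y ⟩
    y                      ∎
    where open ≡-Reasoning

  a*y≤x⇒y≤1/a*x : ∀ {a x y} → 0r < a → a * y ≤ x → y ≤ (1r / a) * x
  a*y≤x⇒y≤1/a*x 0<a a*y≤x =
    ≤-trans (≤-reflexive (sym (1/a*[a*y]≡y (>⇒≢0 0<a) _))) (*-monoˡ-≤ (1/-pos 0<a) a*y≤x)

  x≤b*y⇒1/a*x≤b/a*y : ∀ {a b x y} → 0r < a → x ≤ b * y → (1r / a) * x ≤ (b / a) * y
  x≤b*y⇒1/a*x≤b/a*y {a} {b} {y = y} 0<a x≤b*y =
    ≤-trans (*-monoˡ-≤ (1/-pos 0<a) x≤b*y) (≤-reflexive (begin
    (1r * a ⁻¹) * (b * y)  ≡⟨ cong (_* (b * y)) (*-identityˡ (a ⁻¹)) ⟩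
    a ⁻¹ * (b * y)         ≡⟨ x∙yz≈yx∙z (a ⁻¹) b y ⟩
    (b * a ⁻¹) * y         ∎))
    where open ≡-Reasoning

  b/a*y+y≡[b+a]/a*y : ∀ {a} → ¬ (a ≡ 0r) → ∀ b y → (b / a) * y + y ≡ ((b + a) / a) * y
  b/a*y+y≡[b+a]/a*y {a} a≢0 b y = begin
    (b * a ⁻¹) * y + y                ≡⟨ cong ((b * a ⁻¹) * y +_) (*-identityˡ y) ⟨
    (b * a ⁻¹) * y + 1r * y           ≡⟨ cong (λ z → (b * a ⁻¹) * y + z * y) (⁻¹-inverse a a≢0) ⟨
    (b * a ⁻¹) * y + (a * a ⁻¹) * y   ≡⟨ distribʳ y (b * a ⁻¹) (a * a ⁻¹) ⟨
    (b * a ⁻¹ + a * a ⁻¹) * y         ≡⟨ cong (_* y) (distribʳ (a ⁻¹) b a) ⟨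
    ((b + a) * a ⁻¹) * y              ∎
    where open ≡-Reasoning

  [a+b]+[a-b]≡a+a : ∀ a b → (a + b) + (a - b) ≡ a + a
  [a+b]+[a-b]≡a+a a b = begin
    (a + b) + (a - b)  ≡⟨ interchange a b a (- b) ⟩
    (a + a) + (b - b)  ≡⟨ cong (a + a +_) (-‿inverseʳ b) ⟩
    (a + a) + 0r       ≡⟨ +-identityʳ (a + a) ⟩
    a + a              ∎
    where open ≡-Reasoning

module WalkProperties (F : RealField) {n : ℕ} (G : Graphs.WeightedGraph F n) where
  open RealField F
  open Graphs F
  open WeightedGraph G
  open OrderedFieldProperties F
  open IsCommutativeRing isCommutativeRing using (+-identityˡ; +-identityʳ; +-assoc; +-comm)
  open DecMembership (Data.Fin._≟_ {n}) using (_∈?_)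

  len-nonneg : ∀ {u v} (p : Walk G u v) → 0r ≤ len G p
  len-nonneg [] = ≤-refl
  len-nonneg (e ∷ p) = inj₁ (≤-<-trans (len-nonneg p) (x<y+x _ (w-pos e)))

  suffix : ∀ {u v x} (p : Walk G u v) → x ∈ vertices G p → Walk G x v
  suffix [] (here refl) = []
  suffix (e ∷ p) (here refl) = e ∷ p
  suffix (e ∷ p) (there x∈p) = suffix p x∈p

  prefix : ∀ {u v x} (p : Walk G u v) → x ∈ vertices G p → Walk G u x
  prefix [] (here refl) = []
  prefix (e ∷ p) (here refl) = []
  prefix (e ∷ p) (there x∈p) = e ∷ prefix p x∈p

  len-suffix-≤ : ∀ {u v x} (p : Walk G u v) (x∈p : x ∈ vertices G p) →
                 len G (suffix p x∈p) ≤ len G p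
  len-suffix-≤ [] (here refl) = ≤-refl
  len-suffix-≤ (e ∷ p) (here refl) = ≤-refl
  len-suffix-≤ (e ∷ p) (there x∈p) = ≤-trans (len-suffix-≤ p x∈p) (inj₁ (x<y+x _ (w-pos e)))

  len-prefix-≤ : ∀ {u v x} (p : Walk G u v) (x∈p : x ∈ vertices G p) →
                 len G (prefix p x∈p) ≤ len G p
  len-prefix-≤ [] (here refl) = ≤-refl
  len-prefix-≤ (e ∷ p) (here refl) = len-nonneg (e ∷ p)
  len-prefix-≤ (e ∷ p) (there x∈p) = +-monoʳ-≤ _ (len-prefix-≤ p x∈p)

  suffix-⊆ : ∀ {u v x} (p : Walk G u v) (x∈p : x ∈ vertices G p) →
             vertices G (suffix p x∈p) ⊆ vertices G p
  suffix-⊆ [] (here refl) = λ y∈ → y∈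
  suffix-⊆ (e ∷ p) (here refl) = λ y∈ → y∈
  suffix-⊆ (e ∷ p) (there x∈p) = λ y∈ → there (suffix-⊆ p x∈p y∈)

  suffix-unique : ∀ {u v x} (p : Walk G u v) (x∈p : x ∈ vertices G p) →
                  Unique (vertices G p) → Unique (vertices G (suffix p x∈p))
  suffix-unique [] (here refl) uniq = uniq
  suffix-unique (e ∷ p) (here refl) uniq = uniq
  suffix-unique (e ∷ p) (there x∈p) (_ ∷ uniq) = suffix-unique p x∈p uniq

  -- Loop erasure: if the head vertex recurs in the erased tail, cut the tail back to that occurrence.
  eraseLoops : ∀ {u v} (p : Walk G u v) →
               Σ (Path G u v) (λ q → vertices G (proj₁ q) ⊆ vertices G p)
  eraseLoops [] = ([] , [] ∷ []) , λ x∈ → x∈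
  eraseLoops {u} (e ∷ p) with eraseLoops p
  ... | (q , uniq) , q⊆p with u ∈? vertices G q
  ...   | yes u∈q = (suffix q u∈q , suffix-unique q u∈q uniq) ,
                    λ x∈ → there (q⊆p (suffix-⊆ q u∈q x∈))
  ...   | no u∉q = (e ∷ q , ¬Any⇒All¬ _ u∉q ∷ uniq) , λ where
            (here x≡u) → here x≡u
            (there x∈q) → there (q⊆p x∈q)

  path⊆walk : IsTree G → ∀ {u v} (p : Path G u v) (q : Walk G u v) →
              vertices G (proj₁ p) ⊆ vertices G q
  path⊆walk tree {u} {v} p q x∈p with tree u v | eraseLoops q
  ... | _ , unique | q′ , q′⊆q = q′⊆q (subst (_ ∈_) (trans (unique p) (sym (unique q′))) x∈p)

  _++ʷ_ : ∀ {u v x} → Walk G u v → Walk G v x → Walk G u x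
  [] ++ʷ q = q
  (e ∷ p) ++ʷ q = e ∷ (p ++ʷ q)

  len-++ʷ : ∀ {u v x} (p : Walk G u v) (q : Walk G v x) → len G (p ++ʷ q) ≡ len G p + len G q
  len-++ʷ [] q = sym (+-identityˡ _)
  len-++ʷ (e ∷ p) q = trans (cong (_ +_) (len-++ʷ p q)) (sym (+-assoc _ _ _))

  ∈-++ʷ⁻ : ∀ {u v x y} (p : Walk G u v) (q : Walk G v x) →
           y ∈ vertices G (p ++ʷ q) → y ∈ vertices G p ⊎ y ∈ vertices G q
  ∈-++ʷ⁻ [] q y∈ = inj₂ y∈
  ∈-++ʷ⁻ (e ∷ p) q (here y≡u) = inj₁ (here y≡u)
  ∈-++ʷ⁻ (e ∷ p) q (there y∈) with ∈-++ʷ⁻ p q y∈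
  ... | inj₁ y∈p = inj₁ (there y∈p)
  ... | inj₂ y∈q = inj₂ y∈q

  reverseʷ : ∀ {u v} → Walk G u v → Walk G v u
  reverseʷ [] = []
  reverseʷ (e ∷ p) = reverseʷ p ++ʷ (Adj-sym e ∷ [])

  len-reverseʷ : ∀ {u v} (p : Walk G u v) → len G (reverseʷ p) ≡ len G p
  len-reverseʷ [] = refl
  len-reverseʷ {u} (_∷_ {v = v} e p) = begin
    len G (reverseʷ p ++ʷ (Adj-sym e ∷ []))  ≡⟨ len-++ʷ (reverseʷ p) (Adj-sym e ∷ []) ⟩
    len G (reverseʷ p) + (w v u + 0r)         ≡⟨ cong₂ _+_ (len-reverseʷ p) (+-identityʳ _) ⟩
    len G p + w v u                           ≡⟨ cong (len G p +_) (sym (w-sym e)) ⟩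
    len G p + w u v                           ≡⟨ +-comm _ _ ⟩
    w u v + len G p                           ∎
    where open ≡-Reasoning

module ShortestPathDistance (F : RealField) {n : ℕ} (G : Graphs.WeightedGraph F n)
                            (d : Fin n → Fin n → RealField.ℝ F)
                            (isDist : Graphs.IsShortestPathDist F G d) where
  open RealField F
  open Graphs F
  open OrderedFieldProperties F
  open WalkProperties F G

  geodesic : ∀ u v → Walk G u v
  geodesic u v = proj₁ (proj₁ (isDist u v))

  len-geodesic : ∀ u v → len G (geodesic u v) ≡ d u v
  len-geodesic u v = proj₂ (proj₁ (isDist u v))

  d≤len : ∀ {u v} (p : Walk G u v) → d u v ≤ len G p
  d≤len {u} {v} = proj₂ (isDist u v)

  d-triangle : ∀ u v x → d u x ≤ d u v + d v x
  d-triangle u v x = ≤-trans (d≤len (geodesic u v ++ʷ geodesic v x))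
    (≤-reflexive (trans (len-++ʷ (geodesic u v) (geodesic v x))
                        (cong₂ _+_ (len-geodesic u v) (len-geodesic v x))))

  ∈geodesic⇒d[x,v]≤d[u,v] : ∀ {u v x} (x∈ : x ∈ vertices G (geodesic u v)) → d x v ≤ d u v
  ∈geodesic⇒d[x,v]≤d[u,v] {u} {v} x∈ =
    ≤-trans (d≤len (suffix (geodesic u v) x∈))
            (≤-trans (len-suffix-≤ (geodesic u v) x∈) (≤-reflexive (len-geodesic u v)))

  ∈geodesic⇒d[x,u]≤d[u,v] : ∀ {u v x} (x∈ : x ∈ vertices G (geodesic u v)) → d x u ≤ d u v
  ∈geodesic⇒d[x,u]≤d[u,v] {u} {v} x∈ =
    ≤-trans (d≤len (reverseʷ (prefix (geodesic u v) x∈)))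
            (≤-trans (≤-reflexive (len-reverseʷ (prefix (geodesic u v) x∈)))
                     (≤-trans (len-prefix-≤ (geodesic u v) x∈) (≤-reflexive (len-geodesic u v))))

lemma5 : (F : RealField) →
  let open RealField F
      open Graphs F
  in
  {n : ℕ} (G : WeightedGraph n) (d : Fin n → Fin n → ℝ) →
  IsTree G → IsShortestPathDist G d →
  (r g : Fin n) (ε : ℝ) → 0r < ε → ε < 1r →
  (f : Fin n → ℝ) →
  (∀ v → ((1r - ε) * d v g ≤ f v) × (f v ≤ (1r + ε) * d v g)) →
  let S : Fin n → Set
      S v = d v r ≤ (1r / (1r - ε)) * f r
      OPT = d r g
  in (∀ v → ¬ S v → OPT < d v r)
   × (∀ v → S v → d v r ≤ ((1r + ε) / (1r - ε)) * OPT)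
   × (∀ v → S v → d v g ≤ ((1r + 1r) / (1r - ε)) * OPT)
   × (∀ x → OnPath G r g x → S x)
   × (∀ v → S v → ∀ x → OnPath G v g x → S x)
lemma5 F G d tree isDist r g ε _ ε<1 f f-approx =
    (λ v v∉S → ≤-<-trans OPT≤T (≰⇒> v∉S))
  , (λ v v∈S → ≤-trans v∈S T≤[1+ε]/[1-ε]*OPT)
  , (λ v v∈S → ≤-trans (d-triangle v r g)
                       (≤-trans (+-monoˡ-≤ (d r g) (≤-trans v∈S T≤[1+ε]/[1-ε]*OPT))
                                (≤-reflexive [1+ε]/[1-ε]*OPT+OPT≡2/[1-ε]*OPT)))
  , (λ x (p , x∈p) →
       ≤-trans (∈geodesic⇒d[x,u]≤d[u,v] (path⊆walk tree p (geodesic r g) x∈p)) OPT≤T)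
  , (λ v v∈S x (p , x∈p) →
       [ (λ x∈vr → ≤-trans (∈geodesic⇒d[x,v]≤d[u,v] x∈vr) v∈S)
       , (λ x∈rg → ≤-trans (∈geodesic⇒d[x,u]≤d[u,v] x∈rg) OPT≤T)
       ] (∈-++ʷ⁻ (geodesic v r) (geodesic r g) (path⊆walk tree p _ x∈p)))
  where
  open RealField F
  open OrderedFieldProperties F
  open WalkProperties F G
  open ShortestPathDistance F G d isDist

  0<1-ε : 0r < 1r - ε
  0<1-ε = <⇒0<- ε<1

  OPT≤T : d r g ≤ (1r / (1r - ε)) * f r
  OPT≤T = a*y≤x⇒y≤1/a*x 0<1-ε (proj₁ (f-approx r))

  T≤[1+ε]/[1-ε]*OPT : (1r / (1r - ε)) * f r ≤ ((1r + ε) / (1r - ε)) * d r g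
  T≤[1+ε]/[1-ε]*OPT = x≤b*y⇒1/a*x≤b/a*y 0<1-ε (proj₂ (f-approx r))

  [1+ε]/[1-ε]*OPT+OPT≡2/[1-ε]*OPT :
    ((1r + ε) / (1r - ε)) * d r g + d r g ≡ ((1r + 1r) / (1r - ε)) * d r g
  [1+ε]/[1-ε]*OPT+OPT≡2/[1-ε]*OPT =
    trans (b/a*y+y≡[b+a]/a*y (>⇒≢0 0<1-ε) (1r + ε) (d r g))
          (cong (λ b → (b / (1r - ε)) * d r g) ([a+b]+[a-b]≡a+a 1r ε))
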